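{- Let $G_p$ be the orthogonality graph of the following $24$ vectors in $\mathbb{R}^4$: $(1,0,0,0)$, $(0,1,0,0)$, $(0,0,1,0)$, $(0,0,0,1)$, $(0,1,1,0)$, $(1,0,0,-1)$, $(1,0,0,1)$, $(0,1,-1,0)$, $(1,1,1,1)$, $(1,-1,1,-1)$, $(1,-1,-1,1)$, $(1,1,-1,-1)$, $(1,-1,0,0)$, $(1,1,0,0)$, $(0,0,1,1)$, $(0,0,1,-1)$, $(-1,1,1,1)$, $(1,1,1,-1)$, $(1,-1,1,1)$, $(1,1,-1,1)$, $(1,0,1,0)$, $(0,1,0,1)$, $(1,0,-1,0)$, $(0,1,0,-1)$. Let $\mathcal{C}=\{g\in S_4 : g^2=\mathrm{id},\ g\neq \mathrm{id}\}$ be the set of involutions of the symmetric group $S_4$. Then $G_p$ is isomorphic to the Cayley graph $\mathrm{Cay}(S_4,\mathcal{C})$.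
   Context: The orthogonality graph of a finite set $S$ of vectors in $\mathbb{R}^d$ has vertex set $S$, two vectors being adjacent when their standard inner product is $0$. For a group $G$ and an inverse-closed subset $\mathcal{C}\subseteq G$ not containing the identity, the Cayley graph $\mathrm{Cay}(G,\mathcal{C})$ has vertex set $G$, with $g$ and $h$ adjacent iff $hg^{ -1}\in\mathcal{C}$. -}

module Defs where

open import Data.Nat using (ℕ)
open import Data.Integer using (ℤ; +_; -[1+_]; _+_; _*_)
open import Data.Fin using (Fin)
open import Data.Vec using (Vec; []; _∷_; lookup; foldr; zipWith)
open import Data.Product using (Σ; _×_)
open import Relation.Nullary using (¬_)
open import Relation.Binary.PropositionalEquality using (_≡_)
open import Data.Fin.Permutation using (Permutation′; _≈_; _∘ₚ_; flip; id)

-- Vectors in R^4 with integer coordinates are represented exactly in ℤ^4;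
-- the standard inner product of such vectors coincides with the one over ℤ.

dot : ∀ {d : ℕ} → Vec ℤ d → Vec ℤ d → ℤ
dot u v = foldr _ _+_ (+ 0) (zipWith _*_ u v)

record Graph : Set₁ where
  field
    V   : Set
    _≃V_ : V → V → Set
    Adj : V → V → Set

OrthGraph : ∀ {n d : ℕ} → (Fin n → Vec ℤ d) → Graph
OrthGraph {n} S = record
  { V = Fin n ; _≃V_ = _≡_ ; Adj = λ i j → dot (S i) (S j) ≡ + 0 }

-- Cayley graph of S_4 (permutations of Fin 4, equality = pointwise equality)
-- with connection set given by a predicate C.
-- g ~ h iff h g⁻¹ ∈ C; note π ∘ₚ ρ applies π first, so h g⁻¹ = flip g ∘ₚ h.
CayS4 : (Permutation′ 4 → Set) → Graph
CayS4 C = record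
  { V = Permutation′ 4 ; _≃V_ = _≈_ ; Adj = λ g h → C (flip g ∘ₚ h) }

Involution : Permutation′ 4 → Set
Involution g = ((g ∘ₚ g) ≈ id) × ¬ (g ≈ id)

record _≅G_ (G H : Graph) : Set where
  open Graph G renaming (V to V₁; _≃V_ to _≃₁_; Adj to A₁)
  open Graph H renaming (V to V₂; _≃V_ to _≃₂_; Adj to A₂)
  field
    φ         : V₁ → V₂
    φ-cong    : ∀ x y → x ≃₁ y → φ x ≃₂ φ y
    injective : ∀ x y → φ x ≃₂ φ y → x ≃₁ y
    surjective : ∀ z → Σ V₁ (λ x → φ x ≃₂ z)
    adj⇒      : ∀ x y → A₁ x y → A₂ (φ x) (φ y)
    adj⇐      : ∀ x y → A₂ (φ x) (φ y) → A₁ x y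

private
  p1 : ℤ
  p1 = + 1
  m1 : ℤ
  m1 = -[1+ 0 ]
  z : ℤ
  z = + 0

vecsP : Vec (Vec ℤ 4) 24
vecsP =
    (p1 ∷ z ∷ z ∷ z ∷ []) ∷ (z ∷ p1 ∷ z ∷ z ∷ []) ∷ (z ∷ z ∷ p1 ∷ z ∷ []) ∷ (z ∷ z ∷ z ∷ p1 ∷ []) ∷
    (z ∷ p1 ∷ p1 ∷ z ∷ []) ∷ (p1 ∷ z ∷ z ∷ m1 ∷ []) ∷ (p1 ∷ z ∷ z ∷ p1 ∷ []) ∷ (z ∷ p1 ∷ m1 ∷ z ∷ []) ∷
    (p1 ∷ p1 ∷ p1 ∷ p1 ∷ []) ∷ (p1 ∷ m1 ∷ p1 ∷ m1 ∷ []) ∷ (p1 ∷ m1 ∷ m1 ∷ p1 ∷ []) ∷ (p1 ∷ p1 ∷ m1 ∷ m1 ∷ []) ∷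
    (p1 ∷ m1 ∷ z ∷ z ∷ []) ∷ (p1 ∷ p1 ∷ z ∷ z ∷ []) ∷ (z ∷ z ∷ p1 ∷ p1 ∷ []) ∷ (z ∷ z ∷ p1 ∷ m1 ∷ []) ∷
    (m1 ∷ p1 ∷ p1 ∷ p1 ∷ []) ∷ (p1 ∷ p1 ∷ p1 ∷ m1 ∷ []) ∷ (p1 ∷ m1 ∷ p1 ∷ p1 ∷ []) ∷ (p1 ∷ p1 ∷ m1 ∷ p1 ∷ []) ∷
    (p1 ∷ z ∷ p1 ∷ z ∷ []) ∷ (z ∷ p1 ∷ z ∷ p1 ∷ []) ∷ (p1 ∷ z ∷ m1 ∷ z ∷ []) ∷ (z ∷ p1 ∷ z ∷ m1 ∷ []) ∷ []

Gp : Graph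
Gp = OrthGraph (lookup vecsP)

{-# OPTIONS --safe #-}
module Submission where

-- Read (a, b, c, d) as the quaternion a + bi + cj + dk. Up to sign and scale the 24 rays form
-- the binary octahedral group, and conjugation v ↦ q v q̄ permutes the four body diagonals of
-- the cube, giving the isomorphism of the group modulo ±1 with S₄. As ⟨p , q⟩ is the real
-- part of p q̄, two rays are orthogonal exactly when p q̄ is pure, i.e. squares to a negative
-- real, i.e. acts as a half-turn: an involution of the diagonals.

open import Defs
open import Data.Fin using (Fin)
open import Data.Fin.Patterns using (0F; 1F; 2F; 3F)
open import Data.Fin.Properties using (all?; any?; _≟_)
open import Data.Fin.Permutation
  using (Permutation′; _≈_; _∘ₚ_; flip; id; permutation; _⟨$⟩ʳ_)
open import Data.Integer using (ℤ; 0ℤ; 1ℤ; -1ℤ; _+_; _-_; -_; _*_; sign)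
import Data.Integer.Properties as ℤ
open import Data.Nat using (ℕ; zero; suc)
open import Data.Product using (∃; _,_; map₂)
open import Data.Sign using (Sign)
open import Data.Vec using (Vec; []; _∷_; lookup; tabulate)
open import Data.Vec.Properties using (lookup∘tabulate)
open import Function using (_⇔_; mk⇔; Injective; Injection; Equivalence)
open import Function.Properties.Inverse using (↔⇒↣)
open import Relation.Nullary using (Dec; ¬?)
open import Relation.Nullary.Decidable using (map′; from-yes; _×-dec_; _→-dec_)
open import Relation.Binary.PropositionalEquality using (_≡_; refl; sym; trans)

private
  variable
    m n : ℕ
    A B : Set

_⇔-dec_ : Dec A → Dec B → Dec (A ⇔ B)
a? ⇔-dec b? = map′ (λ (to , from) → mk⇔ to from)
                   (λ A⇔B → Equivalence.to A⇔B , Equivalence.from A⇔B)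
                   ((a? →-dec b?) ×-dec (b? →-dec a?))

∀-Vec? : {P : Vec (Fin m) n → Set} → (∀ v → Dec (P v)) → Dec (∀ v → P v)
∀-Vec? {n = zero}  P? = map′ (λ p → λ { [] → p }) (λ ∀P → ∀P []) (P? [])
∀-Vec? {n = suc n} P? = map′ (λ ∀P → λ { (x ∷ v) → ∀P x v }) (λ ∀P x v → ∀P (x ∷ v))
                             (all? λ x → ∀-Vec? λ v → P? (x ∷ v))

injective? : (f : Fin m → Fin n) → Dec (Injective _≡_ _≡_ f)
injective? f = map′ (λ inj {x} {y} → inj x y) (λ inj x y → inj)
                    (all? λ x → all? λ y → (f x ≟ f y) →-dec (x ≟ y))

_≈?_ : (π ρ : Permutation′ n) → Dec (π ≈ ρ)
π ≈? ρ = all? λ i → π ⟨$⟩ʳ i ≟ ρ ⟨$⟩ʳ i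

involution? : (g : Permutation′ 4) → Dec (Involution g)
involution? g = ((g ∘ₚ g) ≈? id) ×-dec ¬? (g ≈? id)

Quaternion : Set
Quaternion = Vec ℤ 4

infixl 7 _·_

_·_ : Quaternion → Quaternion → Quaternion
(a ∷ b ∷ c ∷ d ∷ []) · (a′ ∷ b′ ∷ c′ ∷ d′ ∷ []) =
    a * a′ - b * b′ - c * c′ - d * d′
  ∷ a * b′ + b * a′ + c * d′ - d * c′
  ∷ a * c′ - b * d′ + c * a′ + d * b′
  ∷ a * d′ + b * c′ - c * b′ + d * a′
  ∷ []

conj : Quaternion → Quaternion
conj (a ∷ b ∷ c ∷ d ∷ []) = a ∷ - b ∷ - c ∷ - d ∷ []

bodyDiagonal : Fin 4 → Quaternion
bodyDiagonal 0F = 0ℤ ∷ 1ℤ ∷ 1ℤ ∷ 1ℤ ∷ []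
bodyDiagonal 1F = 0ℤ ∷ 1ℤ ∷ 1ℤ ∷ -1ℤ ∷ []
bodyDiagonal 2F = 0ℤ ∷ 1ℤ ∷ -1ℤ ∷ 1ℤ ∷ []
bodyDiagonal 3F = 0ℤ ∷ 1ℤ ∷ -1ℤ ∷ -1ℤ ∷ []

-- Junk on anything other than a nonzero multiple of a body diagonal.
bodyDiagonalIndex : Quaternion → Fin 4
bodyDiagonalIndex (_ ∷ x ∷ y ∷ z ∷ []) = index (sign (x * y)) (sign (x * z))
  where
  index : Sign → Sign → Fin 4
  index Sign.+ Sign.+ = 0F
  index Sign.+ Sign.- = 1F
  index Sign.- Sign.+ = 2F
  index Sign.- Sign.- = 3F

rotateDiagonals : Quaternion → Fin 4 → Fin 4
rotateDiagonals q k = bodyDiagonalIndex (q · bodyDiagonal k · conj q)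

ray : Fin 24 → Quaternion
ray = lookup vecsP

ray-rotation-inverseˡ : ∀ i k → rotateDiagonals (ray i) (rotateDiagonals (conj (ray i)) k) ≡ k
ray-rotation-inverseˡ = from-yes (all? λ i → all? λ k →
  rotateDiagonals (ray i) (rotateDiagonals (conj (ray i)) k) ≟ k)

ray-rotation-inverseʳ : ∀ i k → rotateDiagonals (conj (ray i)) (rotateDiagonals (ray i) k) ≡ k
ray-rotation-inverseʳ = from-yes (all? λ i → all? λ k →
  rotateDiagonals (conj (ray i)) (rotateDiagonals (ray i) k) ≟ k)

rayPermutation : Fin 24 → Permutation′ 4
rayPermutation i = permutation (rotateDiagonals (ray i)) (rotateDiagonals (conj (ray i)))
                               (ray-rotation-inverseˡ i) (ray-rotation-inverseʳ i)

rayPermutation-injective : ∀ i j → rayPermutation i ≈ rayPermutation j → i ≡ j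
rayPermutation-injective = from-yes (all? λ i → all? λ j →
  (rayPermutation i ≈? rayPermutation j) →-dec (i ≟ j))

injectiveTuples-realised :
  ∀ v → Injective _≡_ _≡_ (lookup v) → ∃ λ i → ∀ k → rayPermutation i ⟨$⟩ʳ k ≡ lookup v k
injectiveTuples-realised = from-yes (∀-Vec? λ v → injective? (lookup v) →-dec
  any? λ i → all? λ k → rayPermutation i ⟨$⟩ʳ k ≟ lookup v k)

injections-realised :
  (f : Fin 4 → Fin 4) → Injective _≡_ _≡_ f → ∃ λ i → ∀ k → rayPermutation i ⟨$⟩ʳ k ≡ f k
injections-realised f f-inj =
  map₂ (λ realises k → trans (realises k) (lookup∘tabulate f k))
       (injectiveTuples-realised (tabulate f) lookup∘tabulate-injective)
  where
  lookup∘tabulate-injective : Injective _≡_ _≡_ (lookup (tabulate f))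
  lookup∘tabulate-injective {x} {y} eq =
    f-inj (trans (sym (lookup∘tabulate f x)) (trans eq (lookup∘tabulate f y)))

rayPermutation-surjective : ∀ π → ∃ λ i → rayPermutation i ≈ π
rayPermutation-surjective π = injections-realised (π ⟨$⟩ʳ_) (Injection.injective (↔⇒↣ π))

orthogonal⇔involution : ∀ i j →
  (dot (ray i) (ray j) ≡ 0ℤ) ⇔ Involution (flip (rayPermutation i) ∘ₚ rayPermutation j)
orthogonal⇔involution = from-yes (all? λ i → all? λ j →
  (dot (ray i) (ray j) ℤ.≟ 0ℤ) ⇔-dec involution? (flip (rayPermutation i) ∘ₚ rayPermutation j))

mainTheorem1 : Gp ≅G CayS4 Involution
mainTheorem1 = record
  { φ          = rayPermutation
  ; φ-cong     = λ { _ _ refl _ → refl }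
  ; injective  = rayPermutation-injective
  ; surjective = rayPermutation-surjective
  ; adj⇒       = λ i j → Equivalence.to (orthogonal⇔involution i j)
  ; adj⇐       = λ i j → Equivalence.from (orthogonal⇔involution i j)
  }
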